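{- Let $\lambda$ be a nonzero real number. For every integer $n\ge 0$, $$\sum_{m=0}^{n}(-1)^{m}d_{m,\lambda}S_{2,-\lambda}(n,m)=\sum_{m=0}^{n}\binom{n}{m}\mathrm{Bel}_{m,-\lambda}(-1)_{n-m,-\lambda},$$ and $$\sum_{k=0}^{n}\mathrm{Bel}_{k,\lambda}S_{1,\lambda}(n,k)=(-1)^{n}(-1)_{n,-\lambda}.$$
   Context: For a nonzero real $\mu$ (used below with $\mu=\lambda$ and $\mu=-\lambda$), the degenerate falling factorial is $(x)_{0,\mu}=1$ and $(x)_{n,\mu}=x(x-\mu)\cdots(x-(n-1)\mu)$ for $n\ge1$; the degenerate exponential function is $e_{\mu}^{x}(t)=(1+\mu t)^{x/\mu}=\sum_{n\ge0}(x)_{n,\mu}\frac{t^n}{n!}$, $e_\mu(t)=e_\mu^1(t)$, and $\log_\mu(t)=\frac{t^\mu-1}{\mu}$ is the compositional inverse of $e_\mu(t)$. The degenerate derangement polynomials $d_{n,\lambda}(x)$ are defined by $\frac{1}{1-t}e_{\lambda}^{x-1}(t)=\sum_{n\ge0}d_{n,\lambda}(x)\frac{t^n}{n!}$, and $d_{n,\lambda}=d_{n,\lambda}(0)$. The fully degenerate Bell polynomials are defined by $e_{\mu}(x(e_{\mu}(t)-1))=\sum_{n\ge0}\mathrm{Bel}_{n,\mu}(x)\frac{t^n}{n!}$, and $\mathrm{Bel}_{n,\mu}=\mathrm{Bel}_{n,\mu}(1)$. The degenerate Stirling numbers of the first kind are defined by $\frac{1}{m!}(\log_\mu(1+t))^m=\sum_{n\ge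 m}S_{1,\mu}(n,m)\frac{t^n}{n!}$, and those of the second kind by $\frac{1}{m!}(e_{\mu}(t)-1)^m=\sum_{n\ge m}S_{2,\mu}(n,m)\frac{t^n}{n!}$, for $m\ge0$.
   Formalization: The parameter λ ranges over the nonzero rationals rather than the nonzero reals. -}

module Defs where

open import Data.Nat as ℕ using (ℕ; zero; suc; _∸_; _!)
open import Data.Nat.Properties using (_!≢0)
open import Data.Nat.Combinatorics using (_C_)
open import Data.Integer using (+_)
open import Data.Rational using (ℚ; 0ℚ; 1ℚ; _+_; _*_; -_; _-_; _÷_; _/_; NonZero)

Σ≤ : ℕ → (ℕ → ℚ) → ℚ
Σ≤ zero    f = f 0
Σ≤ (suc n) f = Σ≤ n f + f (suc n)

ℕ→ℚ : ℕ → ℚ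
ℕ→ℚ n = + n / 1

sign : ℕ → ℚ
sign zero    = 1ℚ
sign (suc n) = - sign n

ff : ℚ → ℕ → ℚ → ℚ
ff x zero    μ = 1ℚ
ff x (suc n) μ = ff x n μ * (x - ℕ→ℚ n * μ)

-- Formal power series over ℚ, represented by their ordinary coefficients
Series : Set
Series = ℕ → ℚ

invFact : ℕ → ℚ
invFact n = _/_ (+ 1) (n !) {{n !≢0}}

egf : (ℕ → ℚ) → Series
egf a n = a n * invFact n
coeffE : Series → ℕ → ℚ
coeffE f n = ℕ→ℚ (n !) * f n

constS : ℚ → Series
constS c zero    = c
constS c (suc n) = 0ℚ

_⊕_ _⊖_ _⊗_ : Series → Series → Series
(f ⊕ g) n = f n + g n
(f ⊖ g) n = f n - g n
(f ⊗ g) n = Σ≤ n (λ k → f k * g (n ∸ k))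

scaleS : ℚ → Series → Series
scaleS c f n = c * f n

powS : Series → ℕ → Series
powS f zero    = constS 1ℚ
powS f (suc k) = powS f k ⊗ f

-- composition g(f(t)), for f with zero constant term:
-- [t^n] g(f(t)) = Σ_{k=0}^{n} g_k [t^n] f(t)^k
compS : Series → Series → Series
compS g f n = Σ≤ n (λ k → g k * powS f k n)

geomS : Series
geomS n = 1ℚ

eDeg : ℚ → ℚ → Series
eDeg μ x = egf (λ n → ff x n μ)

eDeg1 : ℚ → Series
eDeg1 μ = eDeg μ 1ℚ

-- log_μ(1+t) = ((1+t)^μ - 1)/μ, where (1+t)^μ = e_1^μ(t) = Σ (μ)_{n,1} t^n/n!
logDeg1+ : (μ : ℚ) → .{{NonZero μ}} → Series
logDeg1+ μ n = ((eDeg 1ℚ μ ⊖ constS 1ℚ) n) ÷ μ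

dPoly : ℚ → ℕ → ℚ → ℚ
dPoly λ' n x = coeffE (geomS ⊗ eDeg λ' (x - 1ℚ)) n

d : ℚ → ℕ → ℚ
d λ' n = dPoly λ' n 0ℚ

BelPoly : ℚ → ℕ → ℚ → ℚ
BelPoly μ n x = coeffE (compS (eDeg1 μ) (scaleS x (eDeg1 μ ⊖ constS 1ℚ))) n

Bel : ℚ → ℕ → ℚ
Bel μ n = BelPoly μ n 1ℚ

S₂ : ℚ → ℕ → ℕ → ℚ
S₂ μ n m = coeffE (scaleS (invFact m) (powS (eDeg1 μ ⊖ constS 1ℚ) m)) n

S₁ : (μ : ℚ) → .{{NonZero μ}} → ℕ → ℕ → ℚ
S₁ μ n m = coeffE (scaleS (invFact m) (powS (logDeg1+ μ) m)) n

{-# OPTIONS --safe #-}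
-- Both identities are read off exponential generating functions, handled as formal
-- power series over ℚ.  Write e = e_{−λ}(t) − 1.  By the EGF composition formula the
-- first left-hand side is n!·[tⁿ] of G_λ(−e), where G_λ(s) = e_λ^{−1}(s)/(1 − s) is the
-- derangement EGF.  Since 1/(1 + e) = e_{−λ}^{−1}(t) and e_λ^{−1}(−e) = e_{−λ}(e), this is
-- Bel_{−λ}(t)·e_{−λ}^{−1}(t), whose coefficients are the binomial convolution on the right.
-- The second left-hand side is n!·[tⁿ] of e_λ(e_λ(L) − 1) with L = log_λ(1 + t); as
-- e_λ(L) = 1 + t this is e_λ(t), with coefficients (1)_{n,λ} = (−1)ⁿ(−1)_{n,−λ}.
-- The two analytic facts, e_μ^x e_μ^y = e_μ^{x+y} and e_λ(log_λ(1 + t)) = 1 + t, come from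
-- uniqueness of solutions of A y′ = B y with A(0) = 1, as e_μ^x solves (1 + μt) y′ = x y.

module Submission where

open import Defs hiding (_⊕_; _⊖_; _⊗_)
open import Defs using () renaming (_⊕_ to infixl 6 _⊕_; _⊖_ to infixl 6 _⊖_; _⊗_ to infixl 7 _⊗_)
open import Level using (0ℓ)
open import Algebra.Bundles using (CommutativeSemigroup)
open import Data.Nat as ℕ using (ℕ; zero; suc; _∸_; _!; _≤_; _<_; z≤n; s≤s)
import Data.Nat.Properties as ℕₚ
open import Data.Nat.Combinatorics using (_C_; nCk≡n!/k![n-k]!; k![n∸k]!∣n!)
open import Data.Nat.DivMod using (m/n*n≡m)
open import Data.Nat.Induction using (<-rec)
import Data.Nat.Coprimality as Coprimality
import Data.Integer as ℤ
import Data.Integer.Properties as ℤₚ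
open import Data.Rational using (ℚ; mkℚ; 0ℚ; 1ℚ; _+_; _*_; -_; _-_; _/_; 1/_; NonZero)
open import Data.Rational.Properties
open import Algebra.Properties.Group +-0-group using (x∙y⁻¹≈ε⇒x≈y; ⁻¹-involutive)
open import Data.Product using (_×_; _,_)
open import Relation.Nullary.Decidable using (yes; no; dec⇒maybe)
open import Relation.Binary.Bundles using (Setoid)
open import Relation.Binary.PropositionalEquality
import Relation.Binary.Reasoning.Setoid as SetoidReasoning
open import Tactic.RingSolver using (solve-∀)
import Tactic.RingSolver.Core.AlmostCommutativeRing as ACR

-- Arithmetic in ℚ and finite sums

ℚ-ring : ACR.AlmostCommutativeRing 0ℓ 0ℓ
ℚ-ring = ACR.fromCommutativeRing +-*-commutativeRing (λ x → dec⇒maybe (0ℚ ≟ x))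

x*[y*z]≡y*[x*z] : ∀ x y z → x * (y * z) ≡ y * (x * z)
x*[y*z]≡y*[x*z] = solve-∀ ℚ-ring

x*[y*z]≡[y*x]*z : ∀ x y z → x * (y * z) ≡ (y * x) * z
x*[y*z]≡[y*x]*z = solve-∀ ℚ-ring

*-distribˡ-- : ∀ x y z → x * (y - z) ≡ x * y - x * z
*-distribˡ-- = solve-∀ ℚ-ring

*-distribʳ-- : ∀ x y z → (y - z) * x ≡ y * x - z * x
*-distribʳ-- = solve-∀ ℚ-ring

ℕ→ℚ≡mkℚ : ∀ n → ℕ→ℚ n ≡ mkℚ (ℤ.+ n) 0 (Coprimality.sym (Coprimality.1-coprimeTo n))
ℕ→ℚ≡mkℚ n = normalize-coprime (Coprimality.sym (Coprimality.1-coprimeTo n))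

ℕ→ℚ-suc : ∀ n → ℕ→ℚ (suc n) ≡ 1ℚ + ℕ→ℚ n
ℕ→ℚ-suc n = sym (trans (cong (1ℚ +_) (ℕ→ℚ≡mkℚ n)) (cong (λ m → (ℤ.+ 1 ℤ.+ m) / 1) (ℤₚ.*-identityʳ (ℤ.+ n))))

ℕ→ℚ-+ : ∀ m n → ℕ→ℚ (m ℕ.+ n) ≡ ℕ→ℚ m + ℕ→ℚ n
ℕ→ℚ-+ zero    n = sym (+-identityˡ (ℕ→ℚ n))
ℕ→ℚ-+ (suc m) n = begin
  ℕ→ℚ (suc (m ℕ.+ n))      ≡⟨ ℕ→ℚ-suc (m ℕ.+ n) ⟩
  1ℚ + ℕ→ℚ (m ℕ.+ n)       ≡⟨ cong (1ℚ +_) (ℕ→ℚ-+ m n) ⟩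
  1ℚ + (ℕ→ℚ m + ℕ→ℚ n)     ≡⟨ +-assoc 1ℚ (ℕ→ℚ m) (ℕ→ℚ n) ⟨
  (1ℚ + ℕ→ℚ m) + ℕ→ℚ n     ≡⟨ cong (_+ ℕ→ℚ n) (ℕ→ℚ-suc m) ⟨
  ℕ→ℚ (suc m) + ℕ→ℚ n      ∎
  where open ≡-Reasoning

ℕ→ℚ-* : ∀ m n → ℕ→ℚ (m ℕ.* n) ≡ ℕ→ℚ m * ℕ→ℚ n
ℕ→ℚ-* zero    n = sym (*-zeroˡ (ℕ→ℚ n))
ℕ→ℚ-* (suc m) n = begin
  ℕ→ℚ (n ℕ.+ m ℕ.* n)          ≡⟨ ℕ→ℚ-+ n (m ℕ.* n) ⟩
  ℕ→ℚ n + ℕ→ℚ (m ℕ.* n)        ≡⟨ cong (ℕ→ℚ n +_) (ℕ→ℚ-* m n) ⟩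
  ℕ→ℚ n + ℕ→ℚ m * ℕ→ℚ n        ≡⟨ cong (_+ ℕ→ℚ m * ℕ→ℚ n) (*-identityˡ (ℕ→ℚ n)) ⟨
  1ℚ * ℕ→ℚ n + ℕ→ℚ m * ℕ→ℚ n   ≡⟨ *-distribʳ-+ (ℕ→ℚ n) 1ℚ (ℕ→ℚ m) ⟨
  (1ℚ + ℕ→ℚ m) * ℕ→ℚ n         ≡⟨ cong (_* ℕ→ℚ n) (ℕ→ℚ-suc m) ⟨
  ℕ→ℚ (suc m) * ℕ→ℚ n          ∎
  where open ≡-Reasoning

ℕ→ℚ-nonZero : ∀ n .{{_ : ℕ.NonZero n}} → NonZero (ℕ→ℚ n)
ℕ→ℚ-nonZero (suc n) rewrite ℕ→ℚ≡mkℚ (suc n) = _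

ℕ→ℚ*1/n≡1 : ∀ n .{{_ : ℕ.NonZero n}} → ℕ→ℚ n * (ℤ.+ 1 / n) ≡ 1ℚ
ℕ→ℚ*1/n≡1 (suc n) = begin
  ℕ→ℚ (suc n) * (ℤ.+ 1 / suc n)
    ≡⟨ cong₂ _*_ (ℕ→ℚ≡mkℚ (suc n)) (normalize-coprime (Coprimality.1-coprimeTo (suc n))) ⟩
  n+1 * 1/ n+1  ≡⟨ *-inverseʳ n+1 ⟩
  1ℚ            ∎
  where
  open ≡-Reasoning
  n+1 = mkℚ (ℤ.+ suc n) 0 (Coprimality.sym (Coprimality.1-coprimeTo (suc n)))

*-cancelˡ : ∀ a .{{_ : NonZero a}} {x y} → a * x ≡ a * y → x ≡ y
*-cancelˡ a {x} {y} ax≡ay = begin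
  x               ≡⟨ 1/a*[a*z]≡z x ⟨
  1/ a * (a * x)  ≡⟨ cong (1/ a *_) ax≡ay ⟩
  1/ a * (a * y)  ≡⟨ 1/a*[a*z]≡z y ⟩
  y               ∎
  where
  open ≡-Reasoning
  1/a*[a*z]≡z : ∀ z → 1/ a * (a * z) ≡ z
  1/a*[a*z]≡z z = trans (sym (*-assoc (1/ a) a z)) (trans (cong (_* z) (*-inverseˡ a)) (*-identityˡ z))

n!*invFact[n]≡1 : ∀ n → ℕ→ℚ (n !) * invFact n ≡ 1ℚ
n!*invFact[n]≡1 n = ℕ→ℚ*1/n≡1 (n !) {{n ℕₚ.!≢0}}

[1+n]*invFact[1+n]≡invFact[n] : ∀ n → ℕ→ℚ (suc n) * invFact (suc n) ≡ invFact n
[1+n]*invFact[1+n]≡invFact[n] n = *-cancelˡ (ℕ→ℚ (n !)) {{ℕ→ℚ-nonZero (n !) {{n ℕₚ.!≢0}}}} (begin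
  ℕ→ℚ (n !) * (ℕ→ℚ (suc n) * invFact (suc n))  ≡⟨ x*[y*z]≡[y*x]*z (ℕ→ℚ (n !)) (ℕ→ℚ (suc n)) (invFact (suc n)) ⟩
  (ℕ→ℚ (suc n) * ℕ→ℚ (n !)) * invFact (suc n)  ≡⟨ cong (_* invFact (suc n)) (ℕ→ℚ-* (suc n) (n !)) ⟨
  ℕ→ℚ (suc n !) * invFact (suc n)              ≡⟨ n!*invFact[n]≡1 (suc n) ⟩
  1ℚ                                           ≡⟨ n!*invFact[n]≡1 n ⟨
  ℕ→ℚ (n !) * invFact n                        ∎)
  where open ≡-Reasoning

nCk*[k!*[n∸k]!]≡n! : ∀ {n k} → k ≤ n → ℕ→ℚ (n C k) * (ℕ→ℚ (k !) * ℕ→ℚ ((n ∸ k) !)) ≡ ℕ→ℚ (n !)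
nCk*[k!*[n∸k]!]≡n! {n} {k} k≤n = begin
  ℕ→ℚ (n C k) * (ℕ→ℚ (k !) * ℕ→ℚ ((n ∸ k) !))  ≡⟨ cong (ℕ→ℚ (n C k) *_) (ℕ→ℚ-* (k !) ((n ∸ k) !)) ⟨
  ℕ→ℚ (n C k) * ℕ→ℚ (k ! ℕ.* (n ∸ k) !)        ≡⟨ ℕ→ℚ-* (n C k) (k ! ℕ.* (n ∸ k) !) ⟨
  ℕ→ℚ ((n C k) ℕ.* (k ! ℕ.* (n ∸ k) !))        ≡⟨ cong ℕ→ℚ nCk*k![n∸k]!≡n! ⟩
  ℕ→ℚ (n !)                                   ∎
  where
  open ≡-Reasoning
  instance _ = k ℕₚ.!* (n ∸ k) !≢0
  nCk*k![n∸k]!≡n! : (n C k) ℕ.* (k ! ℕ.* (n ∸ k) !) ≡ n !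
  nCk*k![n∸k]!≡n! = trans (cong (ℕ._* (k ! ℕ.* (n ∸ k) !)) (nCk≡n!/k![n-k]! k≤n)) (m/n*n≡m (k![n∸k]!∣n! k≤n))

Σ≤-cong : ∀ n {f g : ℕ → ℚ} → (∀ k → k ≤ n → f k ≡ g k) → Σ≤ n f ≡ Σ≤ n g
Σ≤-cong zero    f≡g = f≡g 0 z≤n
Σ≤-cong (suc n) f≡g = cong₂ _+_ (Σ≤-cong n (λ k k≤n → f≡g k (ℕₚ.m≤n⇒m≤1+n k≤n))) (f≡g (suc n) ℕₚ.≤-refl)

Σ≤-zero : ∀ n {f : ℕ → ℚ} → (∀ k → k ≤ n → f k ≡ 0ℚ) → Σ≤ n f ≡ 0ℚ
Σ≤-zero zero    f≡0 = f≡0 0 z≤n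
Σ≤-zero (suc n) f≡0 =
  cong₂ _+_ (Σ≤-zero n (λ k k≤n → f≡0 k (ℕₚ.m≤n⇒m≤1+n k≤n))) (f≡0 (suc n) ℕₚ.≤-refl)

Σ≤-distrib-+ : ∀ n (f g : ℕ → ℚ) → Σ≤ n (λ k → f k + g k) ≡ Σ≤ n f + Σ≤ n g
Σ≤-distrib-+ zero    f g = refl
Σ≤-distrib-+ (suc n) f g =
  trans (cong (_+ (f (suc n) + g (suc n))) (Σ≤-distrib-+ n f g))
        (+-interchange (Σ≤ n f) (Σ≤ n g) (f (suc n)) (g (suc n)))
  where +-interchange : ∀ a b c d → (a + b) + (c + d) ≡ (a + c) + (b + d)
        +-interchange = solve-∀ ℚ-ring

Σ≤-distrib-- : ∀ n (f g : ℕ → ℚ) → Σ≤ n (λ k → f k - g k) ≡ Σ≤ n f - Σ≤ n g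
Σ≤-distrib-- n f g = begin
  Σ≤ n (λ k → f k + - g k)     ≡⟨ Σ≤-distrib-+ n f (λ k → - g k) ⟩
  Σ≤ n f + Σ≤ n (λ k → - g k)  ≡⟨ cong (Σ≤ n f +_) (neg-Σ≤ n) ⟩
  Σ≤ n f - Σ≤ n g              ∎
  where
  open ≡-Reasoning
  neg-Σ≤ : ∀ n → Σ≤ n (λ k → - g k) ≡ - Σ≤ n g
  neg-Σ≤ zero    = refl
  neg-Σ≤ (suc n) = trans (cong (_- g (suc n)) (neg-Σ≤ n)) (sym (neg-distrib-+ (Σ≤ n g) (g (suc n))))

*-distribˡ-Σ≤ : ∀ n c (f : ℕ → ℚ) → c * Σ≤ n f ≡ Σ≤ n (λ k → c * f k)
*-distribˡ-Σ≤ zero    c f = refl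
*-distribˡ-Σ≤ (suc n) c f =
  trans (*-distribˡ-+ c (Σ≤ n f) (f (suc n))) (cong (_+ c * f (suc n)) (*-distribˡ-Σ≤ n c f))

*-distribʳ-Σ≤ : ∀ n c (f : ℕ → ℚ) → Σ≤ n f * c ≡ Σ≤ n (λ k → f k * c)
*-distribʳ-Σ≤ n c f = trans (*-comm (Σ≤ n f) c) (trans (*-distribˡ-Σ≤ n c f) (Σ≤-cong n (λ k _ → *-comm c (f k))))

Σ≤-head : ∀ n (f : ℕ → ℚ) → Σ≤ (suc n) f ≡ f 0 + Σ≤ n (λ k → f (suc k))
Σ≤-head zero    f = refl
Σ≤-head (suc n) f = trans (cong (_+ f (suc (suc n))) (Σ≤-head n f)) (+-assoc (f 0) _ _)

Σ≤-comm : ∀ m n (F : ℕ → ℕ → ℚ) → Σ≤ m (λ i → Σ≤ n (F i)) ≡ Σ≤ n (λ j → Σ≤ m (λ i → F i j))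
Σ≤-comm zero    n F = refl
Σ≤-comm (suc m) n F =
  trans (cong (_+ Σ≤ n (F (suc m))) (Σ≤-comm m n F)) (sym (Σ≤-distrib-+ n (λ j → Σ≤ m (λ i → F i j)) (F (suc m))))

Σ≤-extend : ∀ {m n} (f : ℕ → ℚ) → m ≤ n → (∀ k → m < k → f k ≡ 0ℚ) → Σ≤ n f ≡ Σ≤ m f
Σ≤-extend {m} f m≤n f≡0 with ℕₚ.m≤n⇒∃[o]m+o≡n m≤n
... | o , refl = Σ≤[m+o]≡Σ≤[m] o
  where
  Σ≤[m+o]≡Σ≤[m] : ∀ o → Σ≤ (m ℕ.+ o) f ≡ Σ≤ m f
  Σ≤[m+o]≡Σ≤[m] zero    = cong (λ i → Σ≤ i f) (ℕₚ.+-identityʳ m)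
  Σ≤[m+o]≡Σ≤[m] (suc o) = begin
    Σ≤ (m ℕ.+ suc o) f                       ≡⟨ cong (λ i → Σ≤ i f) (ℕₚ.+-suc m o) ⟩
    Σ≤ (m ℕ.+ o) f + f (suc (m ℕ.+ o))      ≡⟨ cong₂ _+_ (Σ≤[m+o]≡Σ≤[m] o) (f≡0 _ (s≤s (ℕₚ.m≤m+n m o))) ⟩
    Σ≤ m f + 0ℚ                              ≡⟨ +-identityʳ (Σ≤ m f) ⟩
    Σ≤ m f                                   ∎
    where open ≡-Reasoning

-- Formal power series

module ≗-Reasoning = SetoidReasoning (ℕ →-setoid ℚ)
open Setoid (ℕ →-setoid ℚ) using () renaming (refl to ≗-refl; sym to ≗-sym; trans to ≗-trans)

X : Series
X zero          = 0ℚ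
X (suc zero)    = 1ℚ
X (suc (suc n)) = 0ℚ

D : Series → Series
D f n = ℕ→ℚ (suc n) * f (suc n)

1+_·X : ℚ → Series
1+ c ·X = constS 1ℚ ⊕ scaleS c X

alternate : Series → Series
alternate f k = sign k * f k

⊕-cong : ∀ {f f′ g g′} → f ≗ f′ → g ≗ g′ → f ⊕ g ≗ f′ ⊕ g′
⊕-cong f≗f′ g≗g′ n = cong₂ _+_ (f≗f′ n) (g≗g′ n)

⊖-cong : ∀ {f f′ g g′} → f ≗ f′ → g ≗ g′ → f ⊖ g ≗ f′ ⊖ g′
⊖-cong f≗f′ g≗g′ n = cong₂ _-_ (f≗f′ n) (g≗g′ n)

scaleS-cong : ∀ c {f g} → f ≗ g → scaleS c f ≗ scaleS c g
scaleS-cong c f≗g n = cong (c *_) (f≗g n)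

⊗-cong : ∀ {f f′ g g′} → f ≗ f′ → g ≗ g′ → f ⊗ g ≗ f′ ⊗ g′
⊗-cong f≗f′ g≗g′ n = Σ≤-cong n (λ k _ → cong₂ _*_ (f≗f′ k) (g≗g′ (n ∸ k)))

⊗-congˡ : ∀ f {g g′} → g ≗ g′ → f ⊗ g ≗ f ⊗ g′
⊗-congˡ f g≗g′ n = Σ≤-cong n (λ k _ → cong (f k *_) (g≗g′ (n ∸ k)))

⊗-congʳ : ∀ g {f f′} → f ≗ f′ → f ⊗ g ≗ f′ ⊗ g
⊗-congʳ g f≗f′ n = Σ≤-cong n (λ k _ → cong (_* g (n ∸ k)) (f≗f′ k))

⊗-distribˡ-⊕ : ∀ f g h → f ⊗ (g ⊕ h) ≗ f ⊗ g ⊕ f ⊗ h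
⊗-distribˡ-⊕ f g h n =
  trans (Σ≤-cong n (λ k _ → *-distribˡ-+ (f k) (g (n ∸ k)) (h (n ∸ k)))) (Σ≤-distrib-+ n _ _)

⊗-distribʳ-⊕ : ∀ f g h → (f ⊕ g) ⊗ h ≗ f ⊗ h ⊕ g ⊗ h
⊗-distribʳ-⊕ f g h n =
  trans (Σ≤-cong n (λ k _ → *-distribʳ-+ (h (n ∸ k)) (f k) (g k))) (Σ≤-distrib-+ n _ _)

⊗-distribˡ-⊖ : ∀ f g h → f ⊗ (g ⊖ h) ≗ f ⊗ g ⊖ f ⊗ h
⊗-distribˡ-⊖ f g h n =
  trans (Σ≤-cong n (λ k _ → *-distribˡ-- (f k) (g (n ∸ k)) (h (n ∸ k)))) (Σ≤-distrib-- n _ _)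

scaleS-⊗ˡ : ∀ c f g → scaleS c f ⊗ g ≗ scaleS c (f ⊗ g)
scaleS-⊗ˡ c f g n = trans (Σ≤-cong n (λ k _ → *-assoc c (f k) (g (n ∸ k)))) (sym (*-distribˡ-Σ≤ n c _))

scaleS-⊗ʳ : ∀ c f g → f ⊗ scaleS c g ≗ scaleS c (f ⊗ g)
scaleS-⊗ʳ c f g n = trans (Σ≤-cong n (λ k _ → x*[y*z]≡y*[x*z] (f k) c (g (n ∸ k)))) (sym (*-distribˡ-Σ≤ n c _))

constS-⊗ : ∀ c f → constS c ⊗ f ≗ scaleS c f
constS-⊗ c f zero    = refl
constS-⊗ c f (suc n) = begin
  Σ≤ (suc n) (λ k → constS c k * f (suc n ∸ k))
    ≡⟨ Σ≤-head n _ ⟩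
  c * f (suc n) + Σ≤ n (λ k → 0ℚ * f (n ∸ k))
    ≡⟨ cong (c * f (suc n) +_) (Σ≤-zero n (λ k _ → *-zeroˡ (f (n ∸ k)))) ⟩
  c * f (suc n) + 0ℚ
    ≡⟨ +-identityʳ (c * f (suc n)) ⟩
  c * f (suc n)
    ∎
  where open ≡-Reasoning

constS-+ : ∀ x y → constS x ⊕ constS y ≗ constS (x + y)
constS-+ x y zero    = refl
constS-+ x y (suc n) = +-identityˡ 0ℚ

⊗-identityˡ : ∀ f → constS 1ℚ ⊗ f ≗ f
⊗-identityˡ f n = trans (constS-⊗ 1ℚ f n) (*-identityˡ (f n))

D-⊗ : ∀ f g → D (f ⊗ g) ≗ D f ⊗ g ⊕ f ⊗ D g
D-⊗ f g n = begin
  n+1 * Σ≤ (suc n) (λ k → f k * g (suc n ∸ k))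
    ≡⟨ *-distribˡ-Σ≤ (suc n) n+1 _ ⟩
  Σ≤ (suc n) (λ k → n+1 * (f k * g (suc n ∸ k)))
    ≡⟨ Σ≤-cong (suc n) split ⟩
  Σ≤ (suc n) (λ k → ℕ→ℚ k * f k * g (suc n ∸ k) + f k * (ℕ→ℚ (suc n ∸ k) * g (suc n ∸ k)))
    ≡⟨ Σ≤-distrib-+ (suc n) _ _ ⟩
  Σ≤ (suc n) (λ k → ℕ→ℚ k * f k * g (suc n ∸ k)) + Σ≤ (suc n) (λ k → f k * (ℕ→ℚ (suc n ∸ k) * g (suc n ∸ k)))
    ≡⟨ cong₂ _+_ Df⊗g f⊗Dg ⟩
  (D f ⊗ g) n + (f ⊗ D g) n
    ∎
  where
  open ≡-Reasoning
  n+1 = ℕ→ℚ (suc n)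
  [a+b]*[x*y]≡a*x*y+x*[b*y] : ∀ a b x y → (a + b) * (x * y) ≡ a * x * y + x * (b * y)
  [a+b]*[x*y]≡a*x*y+x*[b*y] = solve-∀ ℚ-ring
  split : ∀ k → k ≤ suc n →
          n+1 * (f k * g (suc n ∸ k)) ≡ ℕ→ℚ k * f k * g (suc n ∸ k) + f k * (ℕ→ℚ (suc n ∸ k) * g (suc n ∸ k))
  split k k≤1+n = begin
    n+1 * (f k * g (suc n ∸ k))
      ≡⟨ cong (λ m → ℕ→ℚ m * (f k * g (suc n ∸ k))) (ℕₚ.m+[n∸m]≡n k≤1+n) ⟨
    ℕ→ℚ (k ℕ.+ (suc n ∸ k)) * (f k * g (suc n ∸ k))
      ≡⟨ cong (_* (f k * g (suc n ∸ k))) (ℕ→ℚ-+ k (suc n ∸ k)) ⟩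
    (ℕ→ℚ k + ℕ→ℚ (suc n ∸ k)) * (f k * g (suc n ∸ k))
      ≡⟨ [a+b]*[x*y]≡a*x*y+x*[b*y] (ℕ→ℚ k) (ℕ→ℚ (suc n ∸ k)) (f k) (g (suc n ∸ k)) ⟩
    ℕ→ℚ k * f k * g (suc n ∸ k) + f k * (ℕ→ℚ (suc n ∸ k) * g (suc n ∸ k))
      ∎
  Df⊗g : Σ≤ (suc n) (λ k → ℕ→ℚ k * f k * g (suc n ∸ k)) ≡ (D f ⊗ g) n
  Df⊗g = begin
    Σ≤ (suc n) (λ k → ℕ→ℚ k * f k * g (suc n ∸ k))
      ≡⟨ Σ≤-head n _ ⟩
    0ℚ * f 0 * g (suc n) + (D f ⊗ g) n
      ≡⟨ cong (_+ (D f ⊗ g) n) (trans (cong (_* g (suc n)) (*-zeroˡ (f 0))) (*-zeroˡ (g (suc n)))) ⟩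
    0ℚ + (D f ⊗ g) n
      ≡⟨ +-identityˡ ((D f ⊗ g) n) ⟩
    (D f ⊗ g) n
      ∎
  f⊗Dg : Σ≤ (suc n) (λ k → f k * (ℕ→ℚ (suc n ∸ k) * g (suc n ∸ k))) ≡ (f ⊗ D g) n
  f⊗Dg = begin
    Σ≤ n (λ k → f k * (ℕ→ℚ (suc n ∸ k) * g (suc n ∸ k))) + f (suc n) * (ℕ→ℚ (n ∸ n) * g (n ∸ n))
      ≡⟨ cong₂ _+_ (Σ≤-cong n (λ k k≤n → cong (λ m → f k * (ℕ→ℚ m * g m)) (ℕₚ.+-∸-assoc 1 k≤n)))
                   (cong (λ m → f (suc n) * (ℕ→ℚ m * g m)) (ℕₚ.n∸n≡0 n)) ⟩
    (f ⊗ D g) n + f (suc n) * (0ℚ * g 0)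
      ≡⟨ cong ((f ⊗ D g) n +_) (trans (cong (f (suc n) *_) (*-zeroˡ (g 0))) (*-zeroʳ (f (suc n)))) ⟩
    (f ⊗ D g) n + 0ℚ
      ≡⟨ +-identityʳ ((f ⊗ D g) n) ⟩
    (f ⊗ D g) n
      ∎

D-cancel : ∀ f g n → D f n ≡ D g n → f (suc n) ≡ g (suc n)
D-cancel f g n = *-cancelˡ (ℕ→ℚ (suc n)) {{ℕ→ℚ-nonZero (suc n)}}

-- Both sides have the same constant term and, by the product rule and induction on the
-- degree, the same derivative; over ℚ the derivative determines the higher coefficients.
⊗-comm : ∀ f g → f ⊗ g ≗ g ⊗ f
⊗-comm f g zero    = *-comm (f 0) (g 0)
⊗-comm f g (suc n) = D-cancel (f ⊗ g) (g ⊗ f) n (begin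
  D (f ⊗ g) n                 ≡⟨ D-⊗ f g n ⟩
  (D f ⊗ g) n + (f ⊗ D g) n   ≡⟨ cong₂ _+_ (⊗-comm (D f) g n) (⊗-comm f (D g) n) ⟩
  (g ⊗ D f) n + (D g ⊗ f) n   ≡⟨ +-comm ((g ⊗ D f) n) ((D g ⊗ f) n) ⟩
  (D g ⊗ f) n + (g ⊗ D f) n   ≡⟨ D-⊗ g f n ⟨
  D (g ⊗ f) n                 ∎)
  where open ≡-Reasoning

⊗-assoc : ∀ f g h → (f ⊗ g) ⊗ h ≗ f ⊗ (g ⊗ h)
⊗-assoc f g h zero    = *-assoc (f 0) (g 0) (h 0)
⊗-assoc f g h (suc n) = D-cancel ((f ⊗ g) ⊗ h) (f ⊗ (g ⊗ h)) n (begin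
  D ((f ⊗ g) ⊗ h) n
    ≡⟨ D-⊗ (f ⊗ g) h n ⟩
  (D (f ⊗ g) ⊗ h) n + (f ⊗ g ⊗ D h) n
    ≡⟨ cong (_+ (f ⊗ g ⊗ D h) n) (trans (⊗-congʳ h (D-⊗ f g) n) (⊗-distribʳ-⊕ (D f ⊗ g) (f ⊗ D g) h n)) ⟩
  (D f ⊗ g ⊗ h) n + (f ⊗ D g ⊗ h) n + (f ⊗ g ⊗ D h) n
    ≡⟨ cong₂ _+_ (cong₂ _+_ (⊗-assoc (D f) g h n) (⊗-assoc f (D g) h n)) (⊗-assoc f g (D h) n) ⟩
  (D f ⊗ (g ⊗ h)) n + (f ⊗ (D g ⊗ h)) n + (f ⊗ (g ⊗ D h)) n
    ≡⟨ +-assoc ((D f ⊗ (g ⊗ h)) n) _ _ ⟩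
  (D f ⊗ (g ⊗ h)) n + ((f ⊗ (D g ⊗ h)) n + (f ⊗ (g ⊗ D h)) n)
    ≡⟨ cong ((D f ⊗ (g ⊗ h)) n +_) (trans (⊗-congˡ f (D-⊗ g h) n) (⊗-distribˡ-⊕ f (D g ⊗ h) (g ⊗ D h) n)) ⟨
  (D f ⊗ (g ⊗ h)) n + (f ⊗ D (g ⊗ h)) n
    ≡⟨ D-⊗ f (g ⊗ h) n ⟨
  D (f ⊗ (g ⊗ h)) n
    ∎)
  where open ≡-Reasoning

⊗-commutativeSemigroup : CommutativeSemigroup 0ℓ 0ℓ
⊗-commutativeSemigroup = record
  { Carrier                = Series
  ; _≈_                    = _≗_
  ; _∙_                    = _⊗_
  ; isCommutativeSemigroup = record
    { isSemigroup = record
      { isMagma = record { isEquivalence = Setoid.isEquivalence (ℕ →-setoid ℚ) ; ∙-cong = ⊗-cong }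
      ; assoc   = ⊗-assoc
      }
    ; comm        = ⊗-comm
    }
  }

open import Algebra.Properties.CommutativeSemigroup ⊗-commutativeSemigroup
  using (x∙yz≈y∙xz; xy∙z≈xz∙y)

⊗-identityʳ : ∀ f → f ⊗ constS 1ℚ ≗ f
⊗-identityʳ f n = trans (⊗-comm f (constS 1ℚ) n) (⊗-identityˡ f n)

⊗-inverse-unique : ∀ f {g h} → f ⊗ g ≗ constS 1ℚ → f ⊗ h ≗ constS 1ℚ → g ≗ h
⊗-inverse-unique f {g} {h} fg≗1 fh≗1 = begin
  g                  ≈⟨ ⊗-identityʳ g ⟨
  g ⊗ constS 1ℚ      ≈⟨ ⊗-congˡ g fh≗1 ⟨
  g ⊗ (f ⊗ h)        ≈⟨ ⊗-assoc g f h ⟨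
  g ⊗ f ⊗ h          ≈⟨ ⊗-congʳ h (≗-trans (⊗-comm g f) fg≗1) ⟩
  constS 1ℚ ⊗ h      ≈⟨ ⊗-identityˡ h ⟩
  h                  ∎
  where open ≗-Reasoning

Σ≤-X-suc : ∀ n (h : ℕ → ℚ) → Σ≤ n (λ k → X (suc k) * h k) ≡ h 0
Σ≤-X-suc zero    h = *-identityˡ (h 0)
Σ≤-X-suc (suc n) h = trans (cong₂ _+_ (Σ≤-X-suc n h) (*-zeroˡ (h (suc n)))) (+-identityʳ (h 0))

X-⊗-suc : ∀ f n → (X ⊗ f) (suc n) ≡ f n
X-⊗-suc f n = begin
  (X ⊗ f) (suc n)
    ≡⟨ Σ≤-head n _ ⟩
  0ℚ * f (suc n) + Σ≤ n (λ k → X (suc k) * f (n ∸ k))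
    ≡⟨ cong₂ _+_ (*-zeroˡ (f (suc n))) (Σ≤-X-suc n (λ k → f (n ∸ k))) ⟩
  0ℚ + f n
    ≡⟨ +-identityˡ (f n) ⟩
  f n
    ∎
  where open ≡-Reasoning

1+·X-at-0 : ∀ c → (1+ c ·X) 0 ≡ 1ℚ
1+·X-at-0 c = trans (cong (1ℚ +_) (*-zeroʳ c)) (+-identityʳ 1ℚ)

1+·X-⊗ : ∀ c f n → ((1+ c ·X) ⊗ f) n ≡ f n + c * (X ⊗ f) n
1+·X-⊗ c f n = trans (⊗-distribʳ-⊕ (constS 1ℚ) (scaleS c X) f n) (cong₂ _+_ (⊗-identityˡ f n) (scaleS-⊗ˡ c X f n))

geomS-inverse : (1+ - 1ℚ ·X) ⊗ geomS ≗ constS 1ℚ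
geomS-inverse zero    = refl
geomS-inverse (suc n) = trans (1+·X-⊗ (- 1ℚ) geomS (suc n)) (cong (λ a → 1ℚ + - 1ℚ * a) (X-⊗-suc geomS n))

D-constS : ∀ c n → D (constS c) n ≡ 0ℚ
D-constS c n = *-zeroʳ (ℕ→ℚ (suc n))

D-⊖ : ∀ f g → D (f ⊖ g) ≗ D f ⊖ D g
D-⊖ f g n = *-distribˡ-- (ℕ→ℚ (suc n)) (f (suc n)) (g (suc n))

D-1+·X : ∀ c → D (1+ c ·X) ≗ constS c
D-1+·X c zero    = 1*[0+c*1]≡c c
  where 1*[0+c*1]≡c : ∀ c → 1ℚ * (0ℚ + c * 1ℚ) ≡ c
        1*[0+c*1]≡c = solve-∀ ℚ-ring
D-1+·X c (suc n) = trans (cong (ℕ→ℚ (suc (suc n)) *_) (0+c*0≡0 c)) (*-zeroʳ (ℕ→ℚ (suc (suc n))))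
  where 0+c*0≡0 : ∀ c → 0ℚ + c * 0ℚ ≡ 0ℚ
        0+c*0≡0 = solve-∀ ℚ-ring

coeffE-cong : ∀ {f g} → f ≗ g → ∀ n → coeffE f n ≡ coeffE g n
coeffE-cong f≗g n = cong (ℕ→ℚ (n !) *_) (f≗g n)

coeffE-alternate : ∀ g n → coeffE (alternate g) n ≡ sign n * coeffE g n
coeffE-alternate g n = x*[y*z]≡y*[x*z] (ℕ→ℚ (n !)) (sign n) (g n)

coeffE-⊗ : ∀ f g n → coeffE (f ⊗ g) n ≡ Σ≤ n (λ k → ℕ→ℚ (n C k) * coeffE f k * coeffE g (n ∸ k))
coeffE-⊗ f g n = trans (*-distribˡ-Σ≤ n (ℕ→ℚ (n !)) _) (Σ≤-cong n term)
  where
  open ≡-Reasoning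
  shuffle : ∀ c a b x y → c * (a * b) * (x * y) ≡ c * (a * x) * (b * y)
  shuffle = solve-∀ ℚ-ring
  term : ∀ k → k ≤ n → ℕ→ℚ (n !) * (f k * g (n ∸ k)) ≡ ℕ→ℚ (n C k) * coeffE f k * coeffE g (n ∸ k)
  term k k≤n = begin
    ℕ→ℚ (n !) * (f k * g (n ∸ k))
      ≡⟨ cong (_* (f k * g (n ∸ k))) (nCk*[k!*[n∸k]!]≡n! k≤n) ⟨
    ℕ→ℚ (n C k) * (ℕ→ℚ (k !) * ℕ→ℚ ((n ∸ k) !)) * (f k * g (n ∸ k))
      ≡⟨ shuffle (ℕ→ℚ (n C k)) (ℕ→ℚ (k !)) (ℕ→ℚ ((n ∸ k) !)) (f k) (g (n ∸ k)) ⟩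
    ℕ→ℚ (n C k) * coeffE f k * coeffE g (n ∸ k)
      ∎

-- Composition

NoConstantTerm : Series → Set
NoConstantTerm f = f 0 ≡ 0ℚ

powS-cong : ∀ {f g} → f ≗ g → ∀ k → powS f k ≗ powS g k
powS-cong f≗g zero    = λ _ → refl
powS-cong f≗g (suc k) = ⊗-cong (powS-cong f≗g k) f≗g

powS≡0-below : ∀ {f} → NoConstantTerm f → ∀ {n k} → n < k → powS f k n ≡ 0ℚ
powS≡0-below {f} f₀≡0 {n} {suc k} (s≤s n≤k) = Σ≤-zero n term≡0
  where
  term≡0 : ∀ j → j ≤ n → powS f k j * f (n ∸ j) ≡ 0ℚ
  term≡0 j j≤n with j ℕₚ.<? k
  ... | yes j<k = trans (cong (_* f (n ∸ j)) (powS≡0-below f₀≡0 j<k)) (*-zeroˡ (f (n ∸ j)))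
  ... | no  j≮k = begin
    powS f k j * f (n ∸ j)  ≡⟨ cong (λ i → powS f k j * f i) (ℕₚ.m≤n⇒m∸n≡0 (ℕₚ.≤-trans n≤k (ℕₚ.≮⇒≥ j≮k))) ⟩
    powS f k j * f 0        ≡⟨ cong (powS f k j *_) f₀≡0 ⟩
    powS f k j * 0ℚ         ≡⟨ *-zeroʳ (powS f k j) ⟩
    0ℚ                      ∎
    where open ≡-Reasoning

compS-upTo : ∀ {f} → NoConstantTerm f → ∀ g {n N} → n ≤ N → Σ≤ N (λ k → g k * powS f k n) ≡ compS g f n
compS-upTo f₀≡0 g n≤N = Σ≤-extend _ n≤N (λ k n<k → trans (cong (g k *_) (powS≡0-below f₀≡0 n<k)) (*-zeroʳ (g k)))

Σ≤-exchange-compS : ∀ {f} → NoConstantTerm f → ∀ g n (c : ℕ → ℚ) →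
                    Σ≤ n (λ k → g k * Σ≤ n (λ j → powS f k j * c j)) ≡ Σ≤ n (λ j → compS g f j * c j)
Σ≤-exchange-compS {f} f₀≡0 g n c = begin
  Σ≤ n (λ k → g k * Σ≤ n (λ j → powS f k j * c j))
    ≡⟨ Σ≤-cong n (λ k _ → *-distribˡ-Σ≤ n (g k) _) ⟩
  Σ≤ n (λ k → Σ≤ n (λ j → g k * (powS f k j * c j)))
    ≡⟨ Σ≤-comm n n _ ⟩
  Σ≤ n (λ j → Σ≤ n (λ k → g k * (powS f k j * c j)))
    ≡⟨ Σ≤-cong n (λ j _ → trans (Σ≤-cong n (λ k _ → sym (*-assoc (g k) _ _))) (sym (*-distribʳ-Σ≤ n (c j) _))) ⟩
  Σ≤ n (λ j → Σ≤ n (λ k → g k * powS f k j) * c j)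
    ≡⟨ Σ≤-cong n (λ j j≤n → cong (_* c j) (compS-upTo f₀≡0 g j≤n)) ⟩
  Σ≤ n (λ j → compS g f j * c j)
    ∎
  where open ≡-Reasoning

D-powS : ∀ f k → D (powS f (suc k)) ≗ scaleS (ℕ→ℚ (suc k)) (powS f k ⊗ D f)
D-powS f zero n = begin
  D (constS 1ℚ ⊗ f) n
    ≡⟨ D-⊗ (constS 1ℚ) f n ⟩
  (D (constS 1ℚ) ⊗ f) n + (constS 1ℚ ⊗ D f) n
    ≡⟨ cong₂ _+_ (Σ≤-zero n (λ k _ → trans (cong (_* f (n ∸ k)) (D-constS 1ℚ k)) (*-zeroˡ (f (n ∸ k)))))
                 (⊗-identityˡ (D f) n) ⟩
  0ℚ + D f n
    ≡⟨ +-identityˡ (D f n) ⟩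
  D f n
    ≡⟨ trans (*-identityˡ _) (⊗-identityˡ (D f) n) ⟨
  1ℚ * (constS 1ℚ ⊗ D f) n
    ∎
  where open ≡-Reasoning
D-powS f (suc k) n = begin
  D (fᵏ⁺¹ ⊗ f) n
    ≡⟨ D-⊗ fᵏ⁺¹ f n ⟩
  (D fᵏ⁺¹ ⊗ f) n + (fᵏ⁺¹ ⊗ D f) n
    ≡⟨ cong (_+ (fᵏ⁺¹ ⊗ D f) n) (⊗-congʳ f (D-powS f k) n) ⟩
  (scaleS c (powS f k ⊗ D f) ⊗ f) n + (fᵏ⁺¹ ⊗ D f) n
    ≡⟨ cong (_+ (fᵏ⁺¹ ⊗ D f) n) (trans (scaleS-⊗ˡ c _ f n) (cong (c *_) (xy∙z≈xz∙y (powS f k) (D f) f n))) ⟩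
  c * (fᵏ⁺¹ ⊗ D f) n + (fᵏ⁺¹ ⊗ D f) n
    ≡⟨ c*x+x≡[1+c]*x c ((fᵏ⁺¹ ⊗ D f) n) ⟩
  (1ℚ + c) * (fᵏ⁺¹ ⊗ D f) n
    ≡⟨ cong (_* (fᵏ⁺¹ ⊗ D f) n) (ℕ→ℚ-suc (suc k)) ⟨
  ℕ→ℚ (suc (suc k)) * (fᵏ⁺¹ ⊗ D f) n
    ∎
  where
  open ≡-Reasoning
  fᵏ⁺¹ = powS f (suc k)
  c = ℕ→ℚ (suc k)
  c*x+x≡[1+c]*x : ∀ c x → c * x + x ≡ (1ℚ + c) * x
  c*x+x≡[1+c]*x = solve-∀ ℚ-ring

chain-rule : ∀ {f} → NoConstantTerm f → ∀ g → D (compS g f) ≗ compS (D g) f ⊗ D f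
chain-rule {f} f₀≡0 g n = begin
  ℕ→ℚ (suc n) * Σ≤ (suc n) (λ k → g k * powS f k (suc n))
    ≡⟨ *-distribˡ-Σ≤ (suc n) (ℕ→ℚ (suc n)) _ ⟩
  Σ≤ (suc n) (λ k → ℕ→ℚ (suc n) * (g k * powS f k (suc n)))
    ≡⟨ Σ≤-cong (suc n) (λ k _ → x*[y*z]≡y*[x*z] (ℕ→ℚ (suc n)) (g k) _) ⟩
  Σ≤ (suc n) (λ k → g k * D (powS f k) n)
    ≡⟨ Σ≤-head n _ ⟩
  g 0 * D (constS 1ℚ) n + Σ≤ n (λ k → g (suc k) * D (powS f (suc k)) n)
    ≡⟨ cong₂ _+_ (trans (cong (g 0 *_) (D-constS 1ℚ n)) (*-zeroʳ (g 0)))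
                 (Σ≤-cong n (λ k _ → trans (cong (g (suc k) *_) (D-powS f k n))
                                           (x*[y*z]≡[y*x]*z (g (suc k)) (ℕ→ℚ (suc k)) ((powS f k ⊗ D f) n)))) ⟩
  0ℚ + Σ≤ n (λ k → D g k * (powS f k ⊗ D f) n)
    ≡⟨ +-identityˡ _ ⟩
  Σ≤ n (λ k → D g k * Σ≤ n (λ i → powS f k i * D f (n ∸ i)))
    ≡⟨ Σ≤-exchange-compS f₀≡0 (D g) n (λ i → D f (n ∸ i)) ⟩
  (compS (D g) f ⊗ D f) n
    ∎
  where open ≡-Reasoning

compS-cong : ∀ {g g′ f f′} → g ≗ g′ → f ≗ f′ → compS g f ≗ compS g′ f′
compS-cong g≗g′ f≗f′ n = Σ≤-cong n (λ k _ → cong₂ _*_ (g≗g′ k) (powS-cong f≗f′ k n))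

compS-⊕ : ∀ g h f → compS (g ⊕ h) f ≗ compS g f ⊕ compS h f
compS-⊕ g h f n = trans (Σ≤-cong n (λ k _ → *-distribʳ-+ (powS f k n) (g k) (h k))) (Σ≤-distrib-+ n _ _)

compS-⊖ : ∀ g h f → compS (g ⊖ h) f ≗ compS g f ⊖ compS h f
compS-⊖ g h f n = trans (Σ≤-cong n (λ k _ → *-distribʳ-- (powS f k n) (g k) (h k))) (Σ≤-distrib-- n _ _)

compS-scaleS : ∀ c g f → compS (scaleS c g) f ≗ scaleS c (compS g f)
compS-scaleS c g f n = trans (Σ≤-cong n (λ k _ → *-assoc c (g k) (powS f k n))) (sym (*-distribˡ-Σ≤ n c _))

compS-constS : ∀ c f → compS (constS c) f ≗ constS c
compS-constS c f zero    = *-identityʳ c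
compS-constS c f (suc n) = begin
  Σ≤ (suc n) (λ k → constS c k * powS f k (suc n))
    ≡⟨ Σ≤-head n _ ⟩
  c * 0ℚ + Σ≤ n (λ k → 0ℚ * powS f (suc k) (suc n))
    ≡⟨ cong₂ _+_ (*-zeroʳ c) (Σ≤-zero n (λ k _ → *-zeroˡ (powS f (suc k) (suc n)))) ⟩
  0ℚ + 0ℚ
    ≡⟨ +-identityˡ 0ℚ ⟩
  0ℚ
    ∎
  where open ≡-Reasoning

compS-identityˡ : ∀ {f} → NoConstantTerm f → compS X f ≗ f
compS-identityˡ f₀≡0 zero    = trans (*-zeroˡ 1ℚ) (sym f₀≡0)
compS-identityˡ {f} f₀≡0 (suc n) = begin
  Σ≤ (suc n) (λ k → X k * powS f k (suc n))
    ≡⟨ Σ≤-head n _ ⟩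
  0ℚ * 0ℚ + Σ≤ n (λ k → X (suc k) * powS f (suc k) (suc n))
    ≡⟨ cong₂ _+_ (*-zeroˡ 0ℚ) (Σ≤-X-suc n (λ k → powS f (suc k) (suc n))) ⟩
  0ℚ + (constS 1ℚ ⊗ f) (suc n)
    ≡⟨ trans (+-identityˡ _) (⊗-identityˡ f (suc n)) ⟩
  f (suc n)
    ∎
  where open ≡-Reasoning

compS-identityʳ : ∀ g → compS g X ≗ g
compS-identityʳ g zero    = *-identityʳ (g 0)
compS-identityʳ g (suc n) = begin
  Σ≤ (suc n) (λ k → g k * powS X k (suc n))
    ≡⟨ Σ≤-head n _ ⟩
  g 0 * 0ℚ + Σ≤ n (λ k → g (suc k) * powS X (suc k) (suc n))
    ≡⟨ cong₂ _+_ (*-zeroʳ (g 0)) (Σ≤-cong n (λ k _ → cong (g (suc k) *_) (powS-X-suc k))) ⟩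
  0ℚ + compS (λ k → g (suc k)) X n
    ≡⟨ +-identityˡ _ ⟩
  compS (λ k → g (suc k)) X n
    ≡⟨ compS-identityʳ (λ k → g (suc k)) n ⟩
  g (suc n)
    ∎
  where
  open ≡-Reasoning
  powS-X-suc : ∀ k → powS X (suc k) (suc n) ≡ powS X k n
  powS-X-suc k = trans (⊗-comm (powS X k) X (suc n)) (X-⊗-suc (powS X k) n)

compS-1+·X : ∀ {f} → NoConstantTerm f → ∀ c → compS (1+ c ·X) f ≗ constS 1ℚ ⊕ scaleS c f
compS-1+·X {f} f₀≡0 c = begin
  compS (constS 1ℚ ⊕ scaleS c X) f
    ≈⟨ compS-⊕ (constS 1ℚ) (scaleS c X) f ⟩
  compS (constS 1ℚ) f ⊕ compS (scaleS c X) f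
    ≈⟨ ⊕-cong (compS-constS 1ℚ f) (≗-trans (compS-scaleS c X f) (scaleS-cong c (compS-identityˡ f₀≡0))) ⟩
  constS 1ℚ ⊕ scaleS c f
    ∎
  where open ≗-Reasoning

⊗-congʳ-≤ : ∀ {f f′} g n → (∀ k → k ≤ n → f k ≡ f′ k) → (f ⊗ g) n ≡ (f′ ⊗ g) n
⊗-congʳ-≤ g n f≡f′ = Σ≤-cong n (λ k k≤n → cong (_* g (n ∸ k)) (f≡f′ k k≤n))

-- Strong induction on the coefficient index: by the chain rule and the product rule, the
-- derivative of either side at n only involves coefficients ≤ n of the same compositions
-- with g or h differentiated.
compS-⊗ : ∀ {f} → NoConstantTerm f → ∀ g h → compS (g ⊗ h) f ≗ compS g f ⊗ compS h f
compS-⊗ {f} f₀≡0 g h n = <-rec P step n g h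
  where
  P : ℕ → Set
  P n = ∀ g h → compS (g ⊗ h) f n ≡ (compS g f ⊗ compS h f) n
  D-product-of-compS : ∀ g h →
    (compS (D g) f ⊗ compS h f ⊕ compS g f ⊗ compS (D h) f) ⊗ D f ≗ D (compS g f ⊗ compS h f)
  D-product-of-compS g h = begin
    (Cg′ ⊗ Ch ⊕ Cg ⊗ Ch′) ⊗ D f
      ≈⟨ ⊗-distribʳ-⊕ (Cg′ ⊗ Ch) (Cg ⊗ Ch′) (D f) ⟩
    Cg′ ⊗ Ch ⊗ D f ⊕ Cg ⊗ Ch′ ⊗ D f
      ≈⟨ ⊕-cong (xy∙z≈xz∙y Cg′ Ch (D f)) (⊗-assoc Cg Ch′ (D f)) ⟩
    Cg′ ⊗ D f ⊗ Ch ⊕ Cg ⊗ (Ch′ ⊗ D f)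
      ≈⟨ ⊕-cong (⊗-congʳ Ch (chain-rule f₀≡0 g)) (⊗-congˡ Cg (chain-rule f₀≡0 h)) ⟨
    D Cg ⊗ Ch ⊕ Cg ⊗ D Ch
      ≈⟨ D-⊗ Cg Ch ⟨
    D (Cg ⊗ Ch)
      ∎
    where
    open ≗-Reasoning
    Cg = compS g f
    Ch = compS h f
    Cg′ = compS (D g) f
    Ch′ = compS (D h) f
  step : ∀ n → (∀ {k} → k < n → P k) → P n
  step zero    _  g h = [x*y]*1≡[x*1]*[y*1] (g 0) (h 0)
    where [x*y]*1≡[x*1]*[y*1] : ∀ x y → (x * y) * 1ℚ ≡ (x * 1ℚ) * (y * 1ℚ)
          [x*y]*1≡[x*1]*[y*1] = solve-∀ ℚ-ring
  step (suc n) ih g h = D-cancel (compS (g ⊗ h) f) (compS g f ⊗ compS h f) n (begin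
    D (compS (g ⊗ h) f) n
      ≡⟨ chain-rule f₀≡0 (g ⊗ h) n ⟩
    (compS (D (g ⊗ h)) f ⊗ D f) n
      ≡⟨ ⊗-congʳ (D f) (≗-trans (compS-cong (D-⊗ g h) ≗-refl) (compS-⊕ (D g ⊗ h) (g ⊗ D h) f)) n ⟩
    ((compS (D g ⊗ h) f ⊕ compS (g ⊗ D h) f) ⊗ D f) n
      ≡⟨ ⊗-congʳ-≤ (D f) n (λ k k≤n → cong₂ _+_ (ih (s≤s k≤n) (D g) h) (ih (s≤s k≤n) g (D h))) ⟩
    ((compS (D g) f ⊗ compS h f ⊕ compS g f ⊗ compS (D h) f) ⊗ D f) n
      ≡⟨ D-product-of-compS g h n ⟩
    D (compS g f ⊗ compS h f) n
      ∎)
    where open ≡-Reasoning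

compS-powS : ∀ {f} → NoConstantTerm f → ∀ g k → compS (powS g k) f ≗ powS (compS g f) k
compS-powS {f} f₀≡0 g zero    = compS-constS 1ℚ f
compS-powS {f} f₀≡0 g (suc k) =
  ≗-trans (compS-⊗ f₀≡0 (powS g k) g) (⊗-congʳ (compS g f) (compS-powS f₀≡0 g k))

compS-assoc : ∀ {f h} → NoConstantTerm f → NoConstantTerm h → ∀ g → compS (compS g f) h ≗ compS g (compS f h)
compS-assoc {f} {h} f₀≡0 h₀≡0 g n = begin
  Σ≤ n (λ j → compS g f j * powS h j n)
    ≡⟨ Σ≤-exchange-compS f₀≡0 g n (λ j → powS h j n) ⟨
  Σ≤ n (λ k → g k * compS (powS f k) h n)
    ≡⟨ Σ≤-cong n (λ k _ → cong (g k *_) (compS-powS h₀≡0 f k n)) ⟩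
  Σ≤ n (λ k → g k * powS (compS f h) k n)
    ∎
  where open ≡-Reasoning

powS-neg : ∀ f k → powS (scaleS (- 1ℚ) f) k ≗ scaleS (sign k) (powS f k)
powS-neg f zero    n = sym (*-identityˡ (constS 1ℚ n))
powS-neg f (suc k) n = begin
  (powS (scaleS (- 1ℚ) f) k ⊗ scaleS (- 1ℚ) f) n
    ≡⟨ ⊗-congʳ (scaleS (- 1ℚ) f) (powS-neg f k) n ⟩
  (scaleS (sign k) (powS f k) ⊗ scaleS (- 1ℚ) f) n
    ≡⟨ scaleS-⊗ˡ (sign k) (powS f k) (scaleS (- 1ℚ) f) n ⟩
  sign k * (powS f k ⊗ scaleS (- 1ℚ) f) n
    ≡⟨ cong (sign k *_) (scaleS-⊗ʳ (- 1ℚ) (powS f k) f n) ⟩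
  sign k * (- 1ℚ * (powS f k ⊗ f) n)
    ≡⟨ s*[-1*x]≡-s*x (sign k) ((powS f k ⊗ f) n) ⟩
  - sign k * (powS f k ⊗ f) n
    ∎
  where
  open ≡-Reasoning
  s*[-1*x]≡-s*x : ∀ s x → s * (- 1ℚ * x) ≡ - s * x
  s*[-1*x]≡-s*x = solve-∀ ℚ-ring

compS-alternate : ∀ g f → compS (alternate g) f ≗ compS g (scaleS (- 1ℚ) f)
compS-alternate g f n = Σ≤-cong n (λ k _ → begin
  sign k * g k * powS f k n                  ≡⟨ *-assoc (sign k) (g k) (powS f k n) ⟩
  sign k * (g k * powS f k n)                ≡⟨ x*[y*z]≡y*[x*z] (g k) (sign k) (powS f k n) ⟨
  g k * (sign k * powS f k n)                ≡⟨ cong (g k *_) (powS-neg f k n) ⟨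
  g k * powS (scaleS (- 1ℚ) f) k n           ∎)
  where open ≡-Reasoning

coeffE-compS : ∀ g f n →
  coeffE (compS g f) n ≡ Σ≤ n (λ k → coeffE g k * coeffE (scaleS (invFact k) (powS f k)) n)
coeffE-compS g f n = trans (*-distribˡ-Σ≤ n (ℕ→ℚ (n !)) _) (Σ≤-cong n (λ k _ → term k))
  where
  open ≡-Reasoning
  shuffle : ∀ c g p a i → c * (g * p) * (a * i) ≡ a * g * (c * (i * p))
  shuffle = solve-∀ ℚ-ring
  term : ∀ k → ℕ→ℚ (n !) * (g k * powS f k n) ≡ coeffE g k * coeffE (scaleS (invFact k) (powS f k)) n
  term k = begin
    ℕ→ℚ (n !) * (g k * powS f k n)
      ≡⟨ *-identityʳ _ ⟨
    ℕ→ℚ (n !) * (g k * powS f k n) * 1ℚ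
      ≡⟨ cong (ℕ→ℚ (n !) * (g k * powS f k n) *_) (n!*invFact[n]≡1 k) ⟨
    ℕ→ℚ (n !) * (g k * powS f k n) * (ℕ→ℚ (k !) * invFact k)
      ≡⟨ shuffle (ℕ→ℚ (n !)) (g k) (powS f k n) (ℕ→ℚ (k !)) (invFact k) ⟩
    ℕ→ℚ (k !) * g k * (ℕ→ℚ (n !) * (invFact k * powS f k n))
      ∎

-- Linear differential equations

⊗-leading-term : ∀ A {F} n → (∀ k → k < n → F k ≡ 0ℚ) → (A ⊗ F) n ≡ A 0 * F n
⊗-leading-term A     zero    _   = refl
⊗-leading-term A {F} (suc n) F≡0 = begin
  (A ⊗ F) (suc n)                                   ≡⟨ Σ≤-head n _ ⟩
  A 0 * F (suc n) + Σ≤ n (λ k → A (suc k) * F (n ∸ k)) ≡⟨ cong (A 0 * F (suc n) +_) (Σ≤-zero n lower-terms≡0) ⟩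
  A 0 * F (suc n) + 0ℚ                              ≡⟨ +-identityʳ _ ⟩
  A 0 * F (suc n)                                   ∎
  where
  open ≡-Reasoning
  lower-terms≡0 : ∀ k → k ≤ n → A (suc k) * F (n ∸ k) ≡ 0ℚ
  lower-terms≡0 k _ = trans (cong (A (suc k) *_) (F≡0 (n ∸ k) (s≤s (ℕₚ.m∸n≤m n k)))) (*-zeroʳ (A (suc k)))

Solves : Series → Series → Series → Set
Solves A B F = A ⊗ D F ≗ B ⊗ F

Solves-⊖ : ∀ A B F G → Solves A B F → Solves A B G → Solves A B (F ⊖ G)
Solves-⊖ A B F G F-sol G-sol = begin
  A ⊗ D (F ⊖ G)          ≈⟨ ⊗-congˡ A (D-⊖ F G) ⟩
  A ⊗ (D F ⊖ D G)        ≈⟨ ⊗-distribˡ-⊖ A (D F) (D G) ⟩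
  A ⊗ D F ⊖ A ⊗ D G      ≈⟨ ⊖-cong F-sol G-sol ⟩
  B ⊗ F ⊖ B ⊗ G          ≈⟨ ⊗-distribˡ-⊖ B F G ⟨
  B ⊗ (F ⊖ G)            ∎
  where open ≗-Reasoning

-- Since A 0 = 1, the equation expresses (n + 1)·W (n + 1) through W 0, …, W n.
Solves⇒≡0 : ∀ A B {W} → A 0 ≡ 1ℚ → Solves A B W → W 0 ≡ 0ℚ → ∀ n → W n ≡ 0ℚ
Solves⇒≡0 A B {W} A₀≡1 W-sol W₀≡0 = <-rec (λ n → W n ≡ 0ℚ) step
  where
  step : ∀ n → (∀ {k} → k < n → W k ≡ 0ℚ) → W n ≡ 0ℚ
  step zero    _  = W₀≡0
  step (suc n) ih = *-cancelˡ (ℕ→ℚ (suc n)) {{ℕ→ℚ-nonZero (suc n)}} (begin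
    D W n
      ≡⟨ *-identityˡ (D W n) ⟨
    1ℚ * D W n
      ≡⟨ cong (_* D W n) A₀≡1 ⟨
    A 0 * D W n
      ≡⟨ ⊗-leading-term A n (λ k k<n → trans (cong (ℕ→ℚ (suc k) *_) (ih (s≤s k<n))) (*-zeroʳ (ℕ→ℚ (suc k)))) ⟨
    (A ⊗ D W) n
      ≡⟨ W-sol n ⟩
    (B ⊗ W) n
      ≡⟨ Σ≤-zero n (λ k _ → trans (cong (B k *_) (ih (s≤s (ℕₚ.m∸n≤m n k)))) (*-zeroʳ (B k))) ⟩
    0ℚ
      ≡⟨ *-zeroʳ (ℕ→ℚ (suc n)) ⟨
    ℕ→ℚ (suc n) * 0ℚ
      ∎)
    where open ≡-Reasoning

Solves-unique : ∀ A B {F G} → A 0 ≡ 1ℚ → Solves A B F → Solves A B G → F 0 ≡ G 0 → F ≗ G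
Solves-unique A B {F} {G} A₀≡1 F-sol G-sol F₀≡G₀ n =
  x∙y⁻¹≈ε⇒x≈y (F n) (G n) (Solves⇒≡0 A B {F ⊖ G} A₀≡1 (Solves-⊖ A B F G F-sol G-sol) (x≈y⇒x-y≡0 F₀≡G₀) n)
  where x≈y⇒x-y≡0 : ∀ {x y} → x ≡ y → x - y ≡ 0ℚ
        x≈y⇒x-y≡0 {x} refl = +-inverseʳ x

-- Degenerate exponentials

coeffE-eDeg : ∀ μ x n → coeffE (eDeg μ x) n ≡ ff x n μ
coeffE-eDeg μ x n = begin
  ℕ→ℚ (n !) * (ff x n μ * invFact n)  ≡⟨ x*[y*z]≡y*[x*z] (ℕ→ℚ (n !)) (ff x n μ) (invFact n) ⟩
  ff x n μ * (ℕ→ℚ (n !) * invFact n)  ≡⟨ cong (ff x n μ *_) (n!*invFact[n]≡1 n) ⟩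
  ff x n μ * 1ℚ                       ≡⟨ *-identityʳ (ff x n μ) ⟩
  ff x n μ                            ∎
  where open ≡-Reasoning

D-eDeg : ∀ μ x n → D (eDeg μ x) n ≡ ff x (suc n) μ * invFact n
D-eDeg μ x n = begin
  ℕ→ℚ (suc n) * (ff x (suc n) μ * invFact (suc n))
    ≡⟨ x*[y*z]≡y*[x*z] (ℕ→ℚ (suc n)) (ff x (suc n) μ) (invFact (suc n)) ⟩
  ff x (suc n) μ * (ℕ→ℚ (suc n) * invFact (suc n))
    ≡⟨ cong (ff x (suc n) μ *_) ([1+n]*invFact[1+n]≡invFact[n] n) ⟩
  ff x (suc n) μ * invFact n
    ∎
  where open ≡-Reasoning

eDeg-solves : ∀ μ x → Solves (1+ μ ·X) (constS x) (eDeg μ x)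
eDeg-solves μ x n = begin
  ((1+ μ ·X) ⊗ D e) n            ≡⟨ 1+·X-⊗ μ (D e) n ⟩
  D e n + μ * (X ⊗ D e) n        ≡⟨ recurrence n ⟩
  x * e n                        ≡⟨ constS-⊗ x e n ⟨
  (constS x ⊗ e) n               ∎
  where
  open ≡-Reasoning
  e = eDeg μ x
  at-zero : ∀ x μ → 1ℚ * (1ℚ * (x - 0ℚ * μ) * 1ℚ) + μ * (0ℚ * (1ℚ * (1ℚ * (x - 0ℚ * μ) * 1ℚ))) ≡ x * (1ℚ * 1ℚ)
  at-zero = solve-∀ ℚ-ring
  at-suc : ∀ a x N μ i → a * (x - N * μ) * i + μ * (N * (a * i)) ≡ x * (a * i)
  at-suc = solve-∀ ℚ-ring
  recurrence : ∀ n → D e n + μ * (X ⊗ D e) n ≡ x * e n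
  recurrence zero    = at-zero x μ
  recurrence (suc n) = begin
    D e (suc n) + μ * (X ⊗ D e) (suc n)
      ≡⟨ cong₂ (λ a b → a + μ * b) (D-eDeg μ x (suc n)) (X-⊗-suc (D e) n) ⟩
    ff x (suc (suc n)) μ * invFact (suc n) + μ * D e n
      ≡⟨ at-suc (ff x (suc n) μ) x (ℕ→ℚ (suc n)) μ (invFact (suc n)) ⟩
    x * e (suc n)
      ∎

eDeg-+ : ∀ μ x y → eDeg μ x ⊗ eDeg μ y ≗ eDeg μ (x + y)
eDeg-+ μ x y = Solves-unique (1+ μ ·X) (constS (x + y)) (1+·X-at-0 μ) product-solves (eDeg-solves μ (x + y)) refl
  where
  Ex = eDeg μ x
  Ey = eDeg μ y
  P = 1+ μ ·X
  product-solves : Solves P (constS (x + y)) (Ex ⊗ Ey)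
  product-solves = begin
    P ⊗ D (Ex ⊗ Ey)
      ≈⟨ ⊗-congˡ P (D-⊗ Ex Ey) ⟩
    P ⊗ (D Ex ⊗ Ey ⊕ Ex ⊗ D Ey)
      ≈⟨ ⊗-distribˡ-⊕ P (D Ex ⊗ Ey) (Ex ⊗ D Ey) ⟩
    P ⊗ (D Ex ⊗ Ey) ⊕ P ⊗ (Ex ⊗ D Ey)
      ≈⟨ ⊕-cong (≗-sym (⊗-assoc P (D Ex) Ey)) (x∙yz≈y∙xz P Ex (D Ey)) ⟩
    P ⊗ D Ex ⊗ Ey ⊕ Ex ⊗ (P ⊗ D Ey)
      ≈⟨ ⊕-cong (⊗-congʳ Ey (eDeg-solves μ x)) (⊗-congˡ Ex (eDeg-solves μ y)) ⟩
    constS x ⊗ Ex ⊗ Ey ⊕ Ex ⊗ (constS y ⊗ Ey)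
      ≈⟨ ⊕-cong (⊗-assoc (constS x) Ex Ey) (x∙yz≈y∙xz Ex (constS y) Ey) ⟩
    constS x ⊗ (Ex ⊗ Ey) ⊕ constS y ⊗ (Ex ⊗ Ey)
      ≈⟨ ⊗-distribʳ-⊕ (constS x) (constS y) (Ex ⊗ Ey) ⟨
    (constS x ⊕ constS y) ⊗ (Ex ⊗ Ey)
      ≈⟨ ⊗-congʳ (Ex ⊗ Ey) (constS-+ x y) ⟩
    constS (x + y) ⊗ (Ex ⊗ Ey)
      ∎
    where open ≗-Reasoning

eDeg-zero : ∀ μ → eDeg μ 0ℚ ≗ constS 1ℚ
eDeg-zero μ zero    = refl
eDeg-zero μ (suc n) = trans (cong (_* invFact (suc n)) (ff-zero n)) (*-zeroˡ (invFact (suc n)))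
  where
  ff-zero : ∀ n → ff 0ℚ (suc n) μ ≡ 0ℚ
  ff-zero zero    = 1*[0-0*μ]≡0 μ
    where 1*[0-0*μ]≡0 : ∀ μ → 1ℚ * (0ℚ - 0ℚ * μ) ≡ 0ℚ
          1*[0-0*μ]≡0 = solve-∀ ℚ-ring
  ff-zero (suc n) = trans (cong (_* (0ℚ - ℕ→ℚ (suc n) * μ)) (ff-zero n)) (*-zeroˡ (0ℚ - ℕ→ℚ (suc n) * μ))

ff-neg : ∀ x μ n → sign n * ff x n μ ≡ ff (- x) n (- μ)
ff-neg x μ zero    = *-identityˡ 1ℚ
ff-neg x μ (suc n) = begin
  - sign n * (ff x n μ * (x - ℕ→ℚ n * μ))      ≡⟨ neg-factor (sign n) (ff x n μ) x (ℕ→ℚ n) μ ⟩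
  sign n * ff x n μ * (- x - ℕ→ℚ n * - μ)      ≡⟨ cong (_* (- x - ℕ→ℚ n * - μ)) (ff-neg x μ n) ⟩
  ff (- x) n (- μ) * (- x - ℕ→ℚ n * - μ)       ∎
  where
  open ≡-Reasoning
  neg-factor : ∀ s f x N μ → - s * (f * (x - N * μ)) ≡ s * f * (- x - N * - μ)
  neg-factor = solve-∀ ℚ-ring

alternate-eDeg : ∀ μ x → alternate (eDeg μ x) ≗ eDeg (- μ) (- x)
alternate-eDeg μ x k = trans (sym (*-assoc (sign k) (ff x k μ) (invFact k))) (cong (_* invFact k) (ff-neg x μ k))

-- The generating functions of the theorem

-- d λ n = coeffE (derangementGF λ) n and Bel μ n = coeffE (bellGF μ) n hold definitionally.
derangementGF : ℚ → Series
derangementGF λ′ = geomS ⊗ eDeg λ′ (0ℚ - 1ℚ)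

bellGF : ℚ → Series
bellGF μ = compS (eDeg1 μ) (scaleS 1ℚ (eDeg1 μ ⊖ constS 1ℚ))

alternate-derangementGF-∘-[e-1] : ∀ λ′ →
  compS (alternate (derangementGF λ′)) (eDeg1 (- λ′) ⊖ constS 1ℚ) ≗ bellGF (- λ′) ⊗ eDeg (- λ′) (- 1ℚ)
alternate-derangementGF-∘-[e-1] λ′ = begin
  compS (alternate (geomS ⊗ K)) F        ≈⟨ compS-alternate (geomS ⊗ K) F ⟩
  compS (geomS ⊗ K) −F                   ≈⟨ compS-⊗ −F₀≡0 geomS K ⟩
  compS geomS −F ⊗ compS K −F            ≈⟨ ⊗-cong geomS∘−F≗G K∘−F≗bellGF ⟩
  G ⊗ bellGF μ                           ≈⟨ ⊗-comm G (bellGF μ) ⟩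
  bellGF μ ⊗ G                           ∎
  where
  open ≗-Reasoning
  μ = - λ′
  E = eDeg1 μ
  F = E ⊖ constS 1ℚ
  −F = scaleS (- 1ℚ) F
  G = eDeg μ (- 1ℚ)
  K = eDeg λ′ (0ℚ - 1ℚ)
  −F₀≡0 : NoConstantTerm −F
  −F₀≡0 = refl
  1-X∘−F≗E : compS (1+ - 1ℚ ·X) −F ≗ E
  1-X∘−F≗E = ≗-trans (compS-1+·X −F₀≡0 (- 1ℚ)) (λ n → a+-1*[-1*[e-a]]≡e (constS 1ℚ n) (E n))
    where a+-1*[-1*[e-a]]≡e : ∀ a e → a + - 1ℚ * (- 1ℚ * (e - a)) ≡ e
          a+-1*[-1*[e-a]]≡e = solve-∀ ℚ-ring
  E⊗geomS∘−F≗1 : E ⊗ compS geomS −F ≗ constS 1ℚ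
  E⊗geomS∘−F≗1 = begin
    E ⊗ compS geomS −F                               ≈⟨ ⊗-congʳ (compS geomS −F) 1-X∘−F≗E ⟨
    compS (1+ - 1ℚ ·X) −F ⊗ compS geomS −F           ≈⟨ compS-⊗ −F₀≡0 (1+ - 1ℚ ·X) geomS ⟨
    compS ((1+ - 1ℚ ·X) ⊗ geomS) −F                  ≈⟨ compS-cong geomS-inverse ≗-refl ⟩
    compS (constS 1ℚ) −F                             ≈⟨ compS-constS 1ℚ −F ⟩
    constS 1ℚ                                        ∎
  geomS∘−F≗G : compS geomS −F ≗ G
  geomS∘−F≗G = ⊗-inverse-unique E E⊗geomS∘−F≗1 (≗-trans (eDeg-+ μ 1ℚ (- 1ℚ)) (eDeg-zero μ))
  K∘−F≗bellGF : compS K −F ≗ bellGF μ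
  K∘−F≗bellGF = begin
    compS K −F               ≈⟨ compS-alternate K F ⟨
    compS (alternate K) F    ≈⟨ compS-cong (alternate-eDeg λ′ (0ℚ - 1ℚ)) (λ n → sym (*-identityˡ (F n))) ⟩
    bellGF μ                 ∎

module _ (λ′ : ℚ) .{{_ : NonZero λ′}} where

  private
    E = eDeg1 λ′
    L = logDeg1+ λ′
    [1+t]^λ′ = eDeg 1ℚ λ′

  L₀≡0 : NoConstantTerm L
  L₀≡0 = *-zeroˡ (1/ λ′)

  logDeg1+-solves : (1+ 1ℚ ·X) ⊗ D L ≗ compS (1+ λ′ ·X) L
  logDeg1+-solves = begin
    (1+ 1ℚ ·X) ⊗ D L                       ≈⟨ ⊗-congˡ (1+ 1ℚ ·X) D-L ⟩
    (1+ 1ℚ ·X) ⊗ scaleS r (D [1+t]^λ′)     ≈⟨ scaleS-⊗ʳ r (1+ 1ℚ ·X) (D [1+t]^λ′) ⟩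
    scaleS r ((1+ 1ℚ ·X) ⊗ D [1+t]^λ′)     ≈⟨ scaleS-cong r (eDeg-solves 1ℚ λ′) ⟩
    scaleS r (constS λ′ ⊗ [1+t]^λ′)        ≈⟨ scaleS-cong r (constS-⊗ λ′ [1+t]^λ′) ⟩
    scaleS r (scaleS λ′ [1+t]^λ′)          ≈⟨ (λ n → r*[λ*p]≡p ([1+t]^λ′ n)) ⟩
    [1+t]^λ′                               ≈⟨ (λ n → a+λ*[[p-a]*r]≡p (constS 1ℚ n) ([1+t]^λ′ n)) ⟨
    constS 1ℚ ⊕ scaleS λ′ L                ≈⟨ compS-1+·X L₀≡0 λ′ ⟨
    compS (1+ λ′ ·X) L                     ∎
    where
    open ≗-Reasoning
    r = 1/ λ′
    D-L : D L ≗ scaleS r (D [1+t]^λ′)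
    D-L n = a*[[p-0]*r]≡r*[a*p] (ℕ→ℚ (suc n)) ([1+t]^λ′ (suc n)) r
      where a*[[p-0]*r]≡r*[a*p] : ∀ a p r → a * ((p - 0ℚ) * r) ≡ r * (a * p)
            a*[[p-0]*r]≡r*[a*p] = solve-∀ ℚ-ring
    r*[λ*p]≡p : ∀ p → r * (λ′ * p) ≡ p
    r*[λ*p]≡p p = trans (sym (*-assoc r λ′ p)) (trans (cong (_* p) (*-inverseˡ λ′)) (*-identityˡ p))
    a+λ*[[p-a]*r]≡p : ∀ a p → a + λ′ * ((p - a) * r) ≡ p
    a+λ*[[p-a]*r]≡p a p = trans (cong (a +_) (x*[y*z]≡y*[x*z] λ′ (p - a) r))
                                 (trans (cong (λ x → a + (p - a) * x) (*-inverseʳ λ′)) (a+[p-a]*1≡p a p))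
      where a+[p-a]*1≡p : ∀ a p → a + (p - a) * 1ℚ ≡ p
            a+[p-a]*1≡p = solve-∀ ℚ-ring

  eDeg-∘-logDeg1+ : compS E L ≗ 1+ 1ℚ ·X
  eDeg-∘-logDeg1+ = Solves-unique (1+ 1ℚ ·X) (constS 1ℚ) (1+·X-at-0 1ℚ) E∘L-solves 1+X-solves refl
    where
    open ≗-Reasoning
    E∘L-solves : Solves (1+ 1ℚ ·X) (constS 1ℚ) (compS E L)
    E∘L-solves = begin
      (1+ 1ℚ ·X) ⊗ D (compS E L)
        ≈⟨ ⊗-congˡ (1+ 1ℚ ·X) (chain-rule L₀≡0 E) ⟩
      (1+ 1ℚ ·X) ⊗ (compS (D E) L ⊗ D L)
        ≈⟨ x∙yz≈y∙xz (1+ 1ℚ ·X) (compS (D E) L) (D L) ⟩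
      compS (D E) L ⊗ ((1+ 1ℚ ·X) ⊗ D L)
        ≈⟨ ⊗-congˡ (compS (D E) L) logDeg1+-solves ⟩
      compS (D E) L ⊗ compS (1+ λ′ ·X) L
        ≈⟨ compS-⊗ L₀≡0 (D E) (1+ λ′ ·X) ⟨
      compS (D E ⊗ 1+ λ′ ·X) L
        ≈⟨ compS-cong (≗-trans (⊗-comm (D E) (1+ λ′ ·X)) (eDeg-solves λ′ 1ℚ)) ≗-refl ⟩
      compS (constS 1ℚ ⊗ E) L
        ≈⟨ compS-cong (⊗-identityˡ E) ≗-refl ⟩
      compS E L
        ≈⟨ ⊗-identityˡ (compS E L) ⟨
      constS 1ℚ ⊗ compS E L
        ∎
    1+X-solves : Solves (1+ 1ℚ ·X) (constS 1ℚ) (1+ 1ℚ ·X)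
    1+X-solves = begin
      (1+ 1ℚ ·X) ⊗ D (1+ 1ℚ ·X)     ≈⟨ ⊗-congˡ (1+ 1ℚ ·X) (D-1+·X 1ℚ) ⟩
      (1+ 1ℚ ·X) ⊗ constS 1ℚ        ≈⟨ ⊗-comm (1+ 1ℚ ·X) (constS 1ℚ) ⟩
      constS 1ℚ ⊗ (1+ 1ℚ ·X)        ∎

  bellGF-∘-logDeg1+ : compS (bellGF λ′) L ≗ E
  bellGF-∘-logDeg1+ = begin
    compS (compS E F) L     ≈⟨ compS-assoc F₀≡0 L₀≡0 E ⟩
    compS E (compS F L)     ≈⟨ compS-cong {E} ≗-refl F∘L≗X ⟩
    compS E X               ≈⟨ compS-identityʳ E ⟩
    E                       ∎
    where
    open ≗-Reasoning
    F = scaleS 1ℚ (E ⊖ constS 1ℚ)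
    F₀≡0 : NoConstantTerm F
    F₀≡0 = refl
    F∘L≗X : compS F L ≗ X
    F∘L≗X = begin
      compS (scaleS 1ℚ (E ⊖ constS 1ℚ)) L
        ≈⟨ compS-scaleS 1ℚ (E ⊖ constS 1ℚ) L ⟩
      scaleS 1ℚ (compS (E ⊖ constS 1ℚ) L)
        ≈⟨ scaleS-cong 1ℚ (compS-⊖ E (constS 1ℚ) L) ⟩
      scaleS 1ℚ (compS E L ⊖ compS (constS 1ℚ) L)
        ≈⟨ scaleS-cong 1ℚ (⊖-cong eDeg-∘-logDeg1+ (compS-constS 1ℚ L)) ⟩
      scaleS 1ℚ (1+ 1ℚ ·X ⊖ constS 1ℚ)
        ≈⟨ (λ n → 1*[[a+1*x]-a]≡x (constS 1ℚ n) (X n)) ⟩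
      X
        ∎
      where 1*[[a+1*x]-a]≡x : ∀ a x → 1ℚ * ((a + 1ℚ * x) - a) ≡ x
            1*[[a+1*x]-a]≡x = solve-∀ ℚ-ring

theorem8 : (λ' : ℚ) → .{{_ : NonZero λ'}} → (n : ℕ) →
    (Σ≤ n (λ m → sign m * d λ' m * S₂ (- λ') n m)
      ≡ Σ≤ n (λ m → ℕ→ℚ (n C m) * Bel (- λ') m * ff (- 1ℚ) (n ∸ m) (- λ')))
    × (Σ≤ n (λ k → Bel λ' k * S₁ λ' n k) ≡ sign n * ff (- 1ℚ) n (- λ'))
theorem8 λ' n = derangement-identity , bell-identity
  where
  open ≡-Reasoning
  derangement-identity : Σ≤ n (λ m → sign m * d λ' m * S₂ (- λ') n m)
                       ≡ Σ≤ n (λ m → ℕ→ℚ (n C m) * Bel (- λ') m * ff (- 1ℚ) (n ∸ m) (- λ'))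
  derangement-identity = begin
    Σ≤ n (λ m → sign m * d λ' m * S₂ (- λ') n m)
      ≡⟨ Σ≤-cong n (λ m _ → cong (_* S₂ (- λ') n m) (coeffE-alternate (derangementGF λ') m)) ⟨
    Σ≤ n (λ m → coeffE (alternate (derangementGF λ')) m * S₂ (- λ') n m)
      ≡⟨ coeffE-compS (alternate (derangementGF λ')) (eDeg1 (- λ') ⊖ constS 1ℚ) n ⟨
    coeffE (compS (alternate (derangementGF λ')) (eDeg1 (- λ') ⊖ constS 1ℚ)) n
      ≡⟨ coeffE-cong (alternate-derangementGF-∘-[e-1] λ') n ⟩
    coeffE (bellGF (- λ') ⊗ eDeg (- λ') (- 1ℚ)) n
      ≡⟨ coeffE-⊗ (bellGF (- λ')) (eDeg (- λ') (- 1ℚ)) n ⟩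
    Σ≤ n (λ m → ℕ→ℚ (n C m) * Bel (- λ') m * coeffE (eDeg (- λ') (- 1ℚ)) (n ∸ m))
      ≡⟨ Σ≤-cong n (λ m _ → cong (ℕ→ℚ (n C m) * Bel (- λ') m *_) (coeffE-eDeg (- λ') (- 1ℚ) (n ∸ m))) ⟩
    Σ≤ n (λ m → ℕ→ℚ (n C m) * Bel (- λ') m * ff (- 1ℚ) (n ∸ m) (- λ'))
      ∎
  bell-identity : Σ≤ n (λ k → Bel λ' k * S₁ λ' n k) ≡ sign n * ff (- 1ℚ) n (- λ')
  bell-identity = begin
    Σ≤ n (λ k → Bel λ' k * S₁ λ' n k)            ≡⟨ coeffE-compS (bellGF λ') (logDeg1+ λ') n ⟨
    coeffE (compS (bellGF λ') (logDeg1+ λ')) n   ≡⟨ coeffE-cong (bellGF-∘-logDeg1+ λ') n ⟩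
    coeffE (eDeg1 λ') n                          ≡⟨ coeffE-eDeg λ' 1ℚ n ⟩
    ff 1ℚ n λ'                                   ≡⟨ cong (ff 1ℚ n) (⁻¹-involutive λ') ⟨
    ff (- - 1ℚ) n (- - λ')                       ≡⟨ ff-neg (- 1ℚ) (- λ') n ⟨
    sign n * ff (- 1ℚ) n (- λ')                  ∎
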